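{- Let $T$ be a full binary tree with $n$ vertices, and let $t = \log_2(n+1) \bmod 3$. Then $\mathrm{cdn}(T) = \dfrac{n+1-2^t}{7}$.
   Context: A claw is $K_{1,3}$. $\mathrm{cdn}(G)$ is the minimum number of vertices whose deletion from $G$ leaves a graph with no induced $K_{1,3}$. A full $k$-ary tree is a rooted tree in which every node has either zero or exactly $k$ children and all leaves have the same depth; a full binary tree is a full $2$-ary tree. -}

module Defs where

open import Data.Nat using (ℕ; zero; suc; _+_; _*_; _∸_; _^_; _≤_)
open import Data.Fin using (Fin; toℕ)
open import Data.Fin.Subset using (Subset; _∈_; _∉_; ∣_∣)
open import Data.Product using (Σ; _×_; ∃)
open import Relation.Binary.PropositionalEquality using (_≡_; _≢_)
open import Relation.Nullary using (¬_)
open import Data.Sum using (_⊎_)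
open import Function.Bundles using (_↔_; Inverse)

-- A (simple, undirected) graph on vertex set Fin n, given by its adjacency
-- relation.  (Symmetry/irreflexivity are not needed as fields: the graphs in
-- the statement are required to be isomorphic to a full binary tree.)
Graph : ℕ → Set₁
Graph n = Fin n → Fin n → Set

Adj : {n : ℕ} → Graph n → Fin n → Fin n → Set
Adj G = G

record InducedClaw {n : ℕ} (G : Graph n) (a b c d : Fin n) : Set where
  field
    a≢b : a ≢ b
    a≢c : a ≢ c
    a≢d : a ≢ d
    b≢c : b ≢ c
    b≢d : b ≢ d
    c≢d : c ≢ d
    ab : Adj G a b
    ac : Adj G a c
    ad : Adj G a d
    ¬bc : ¬ Adj G b c
    ¬bd : ¬ Adj G b d
    ¬cd : ¬ Adj G c d

-- G - S has no induced claw: no induced claw of G avoids S entirely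
-- (induced subgraphs of G - S are exactly induced subgraphs of G avoiding S).
ClawFreeAfterDeleting : {n : ℕ} → Graph n → Subset n → Set
ClawFreeAfterDeleting G S =
  ∀ a b c d → a ∉ S → b ∉ S → c ∉ S → d ∉ S → ¬ InducedClaw G a b c d

IsCdn : {n : ℕ} → Graph n → ℕ → Set
IsCdn {n} G k =
  (Σ (Subset n) λ S → ∣ S ∣ ≡ k × ClawFreeAfterDeleting G S)
  × (∀ (S : Subset n) → ClawFreeAfterDeleting G S → k ≤ ∣ S ∣)

ChildOf : {n : ℕ} → Fin n → Fin n → Set
ChildOf j i = (toℕ j ≡ 2 * toℕ i + 1) ⊎ (toℕ j ≡ 2 * toℕ i + 2)

fullBinaryTree : (h : ℕ) → Graph (2 ^ suc h ∸ 1)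
fullBinaryTree h x y = ChildOf x y ⊎ ChildOf y x

record _≅_ {n m : ℕ} (G : Graph n) (H : Graph m) : Set where
  field
    bij : Fin n ↔ Fin m
    pres : ∀ x y → (Adj G x y → Adj H (Inverse.to bij x) (Inverse.to bij y))
                 × (Adj H (Inverse.to bij x) (Inverse.to bij y) → Adj G x y)

IsFullBinaryTree : {n : ℕ} → Graph n → Set
IsFullBinaryTree G = ∃ λ h → G ≅ fullBinaryTree h

-- Number the vertices of the full binary tree of depth h in heap order (root 1,
-- children of u are 2u and 2u+1), so that level ℓ is the interval [2^ℓ, 2^(ℓ+1)).
-- Deleting the whole levels h-2, h-5, h-8, … leaves a claw-free graph: every
-- claw of a tree has, among its leaves, the parent and a child of its centre, so
-- it spans three consecutive levels, one of which has been deleted.  Conversely,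
-- each deleted vertex u is a leaf of the induced claw with centre 2u and leaves
-- u, 4u, 4u+1, and these claws are pairwise vertex-disjoint, so every
-- claw-hitting set is at least as large.  Summing 2^(h-2) + 2^(h-5) + … gives
-- (2^(h+1) - 2^((h+1) mod 3))/7.

module Submission where

open import Defs
open import Data.Bool using (Bool; true)
open import Data.Bool.Properties using (T-≡)
open import Data.Empty using (⊥; ⊥-elim)
open import Data.Fin using (Fin; zero; suc; toℕ; fromℕ<)
open import Data.Fin.Properties
  using (toℕ-injective; toℕ<n; toℕ-fromℕ<; injective⇒≤; any?)
  renaming (_≟_ to _≟ᶠ_; suc-injective to suc-injectiveᶠ)
open import Data.Fin.Subset using (Subset; _∈_; _∉_; ∣_∣; inside; outside; ⊤; _-_)
open import Data.Fin.Subset.Properties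
  using (∈⊤; ∣⊤∣≡n; _∈?_; x∈p∧x≢y⇒x∈p-y; x∈p⇒∣p-x∣<∣p∣)
open import Data.Nat
  using (ℕ; zero; suc; _+_; _*_; _∸_; _^_; _/_; _%_; _≤_; _<_; z≤n; s≤s; _<?_)
open import Data.Nat.DivMod using (m*n/n≡m; [m+n]%n≡m%n)
open import Data.Nat.Logarithm using (⌊log₂_⌋; ⌊log₂[2^n]⌋≡n)
open import Data.Nat.Properties
open import Data.Nat.Solver using (module +-*-Solver)
open import Data.Product using (∃; ∃₂; _×_; _,_; proj₁; proj₂)
open import Data.Sum using (_⊎_; inj₁; inj₂; swap; [_,_])
open import Data.Vec using (_∷_; []; tabulate; lookup; here; there)
open import Data.Vec.Properties using (lookup∘tabulate; []=⇒lookup; lookup⇒[]=)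
open import Function using (_∘_)
open import Function.Bundles using (_↔_; Inverse; Injection; Equivalence)
open import Function.Properties.Inverse using (↔-sym; ↔⇒↣)
open import Relation.Binary using (tri<; tri≈; tri>)
open import Relation.Binary.PropositionalEquality
  using (_≡_; _≢_; refl; sym; trans; cong; subst; subst₂; ≢-sym; module ≡-Reasoning)
open import Relation.Nullary using (¬_; yes; no; isYes)
open import Relation.Nullary.Decidable using (toWitness; fromWitness)

-- Cardinalities of finite subsets

injectiveOn⇒∣∣≤ : ∀ {n m} (S : Subset n) (T : Subset m) (f : ∀ x → x ∈ S → Fin m) →
  (∀ x x∈S → f x x∈S ∈ T) →
  (∀ x y x∈S y∈S → f x x∈S ≡ f y y∈S → x ≡ y) →
  ∣ S ∣ ≤ ∣ T ∣
injectiveOn⇒∣∣≤ [] T f f∈T f-inj = z≤n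
injectiveOn⇒∣∣≤ (outside ∷ S) T f f∈T f-inj =
  injectiveOn⇒∣∣≤ S T (λ x → f (suc x) ∘ there) (λ x → f∈T (suc x) ∘ there)
    (λ x y x∈S y∈S → suc-injectiveᶠ ∘ f-inj (suc x) (suc y) (there x∈S) (there y∈S))
injectiveOn⇒∣∣≤ (inside ∷ S) T f f∈T f-inj =
  ≤-trans (s≤s ∣S∣≤∣T-f₀∣) (x∈p⇒∣p-x∣<∣p∣ (f∈T zero here))
  where
  f₀ = f zero here

  f₀-fresh : ∀ x x∈S → f (suc x) (there x∈S) ≢ f₀
  f₀-fresh x x∈S eq with f-inj (suc x) zero (there x∈S) here eq
  ... | ()

  ∣S∣≤∣T-f₀∣ : ∣ S ∣ ≤ ∣ T - f₀ ∣
  ∣S∣≤∣T-f₀∣ = injectiveOn⇒∣∣≤ S (T - f₀) (λ x → f (suc x) ∘ there)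
    (λ x x∈S → x∈p∧x≢y⇒x∈p-y (f∈T (suc x) (there x∈S)) (f₀-fresh x x∈S))
    (λ x y x∈S y∈S → suc-injectiveᶠ ∘ f-inj (suc x) (suc y) (there x∈S) (there y∈S))

↔⇒≡ : ∀ {n m} → Fin n ↔ Fin m → n ≡ m
↔⇒≡ n↔m = ≤-antisym (injective⇒≤ (Injection.injective (↔⇒↣ n↔m)))
                    (injective⇒≤ (Injection.injective (↔⇒↣ (↔-sym n↔m))))

∈-tabulate⁺ : ∀ {n} {g : Fin n → Bool} {x} → g x ≡ true → x ∈ tabulate g
∈-tabulate⁺ {g = g} {x} gx≡true = lookup⇒[]= x (tabulate g) (trans (lookup∘tabulate g x) gx≡true)

∈-tabulate⁻ : ∀ {n} {g : Fin n → Bool} {x} → x ∈ tabulate g → g x ≡ true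
∈-tabulate⁻ {g = g} {x} x∈ = trans (sym (lookup∘tabulate g x)) ([]=⇒lookup x∈)

preimage : ∀ {n m} → (Fin n → Fin m) → Subset m → Subset n
preimage f S = tabulate (λ x → lookup S (f x))

∈-preimage⁺ : ∀ {n m} {f : Fin n → Fin m} {S x} → f x ∈ S → x ∈ preimage f S
∈-preimage⁺ fx∈S = ∈-tabulate⁺ ([]=⇒lookup fx∈S)

∈-preimage⁻ : ∀ {n m} {f : Fin n → Fin m} {S x} → x ∈ preimage f S → f x ∈ S
∈-preimage⁻ {f = f} {S} {x} x∈ = lookup⇒[]= (f x) S (∈-tabulate⁻ x∈)

∣preimage∣≤ : ∀ {n m} {f : Fin n → Fin m} → (∀ {x y} → f x ≡ f y → x ≡ y) →
  ∀ S → ∣ preimage f S ∣ ≤ ∣ S ∣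
∣preimage∣≤ {f = f} f-inj S =
  injectiveOn⇒∣∣≤ (preimage f S) S (λ x _ → f x) (λ _ → ∈-preimage⁻) (λ _ _ _ _ → f-inj)

image : ∀ {k n} → (Fin k → Fin n) → Subset n
image f = tabulate (λ y → isYes (any? (λ i → y ≟ᶠ f i)))

∈-image⁺ : ∀ {k n} {f : Fin k → Fin n} i → f i ∈ image f
∈-image⁺ {f = f} i =
  ∈-tabulate⁺ (Equivalence.to T-≡ (fromWitness {a? = any? (λ j → f i ≟ᶠ f j)} (i , refl)))

∈-image⁻ : ∀ {k n} {f : Fin k → Fin n} {y} → y ∈ image f → ∃ λ i → y ≡ f i
∈-image⁻ {f = f} {y} y∈ =
  toWitness {a? = any? (λ i → y ≟ᶠ f i)} (Equivalence.from T-≡ (∈-tabulate⁻ y∈))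

∣image∣≤ : ∀ {k n} (f : Fin k → Fin n) → ∣ image f ∣ ≤ k
∣image∣≤ {k} f = subst (∣ image f ∣ ≤_) (∣⊤∣≡n k)
  (injectiveOn⇒∣∣≤ (image f) ⊤ (λ _ y∈ → proj₁ (∈-image⁻ y∈)) (λ _ _ → ∈⊤)
    (λ _ _ x∈ y∈ i≡j → trans (proj₂ (∈-image⁻ x∈))
                        (trans (cong f i≡j) (sym (proj₂ (∈-image⁻ y∈))))))

-- Claw deletion number

≅-sym : ∀ {n m} {G : Graph n} {H : Graph m} → G ≅ H → H ≅ G
≅-sym {H = H} G≅H = record
  { bij  = ↔-sym bij
  ; pres = λ x y →
      (λ Hxy → proj₂ (pres (from x) (from y))
                 (subst₂ H (sym (strictlyInverseˡ x)) (sym (strictlyInverseˡ y)) Hxy))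
    , (λ Gxy → subst₂ H (strictlyInverseˡ x) (strictlyInverseˡ y)
                 (proj₁ (pres (from x) (from y)) Gxy))
  }
  where open _≅_ G≅H; open Inverse bij

InducedClaw-≅ : ∀ {n m} {G : Graph n} {H : Graph m} (G≅H : G ≅ H) →
  let to = Inverse.to (_≅_.bij G≅H) in
  ∀ {a b c d} → InducedClaw G a b c d → InducedClaw H (to a) (to b) (to c) (to d)
InducedClaw-≅ G≅H claw = record
  { a≢b = to-≢ a≢b ; a≢c = to-≢ a≢c ; a≢d = to-≢ a≢d
  ; b≢c = to-≢ b≢c ; b≢d = to-≢ b≢d ; c≢d = to-≢ c≢d
  ; ab = proj₁ (pres _ _) ab ; ac = proj₁ (pres _ _) ac ; ad = proj₁ (pres _ _) ad
  ; ¬bc = ¬bc ∘ proj₂ (pres _ _) ; ¬bd = ¬bd ∘ proj₂ (pres _ _) ; ¬cd = ¬cd ∘ proj₂ (pres _ _)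
  }
  where
  open _≅_ G≅H
  open InducedClaw claw
  to-≢ : ∀ {x y} → x ≢ y → Inverse.to bij x ≢ Inverse.to bij y
  to-≢ x≢y = x≢y ∘ Injection.injective (↔⇒↣ bij)

ClawFreeAfterDeleting-preimage : ∀ {n m} {G : Graph n} {H : Graph m} (G≅H : G ≅ H) {S} →
  ClawFreeAfterDeleting H S →
  ClawFreeAfterDeleting G (preimage (Inverse.to (_≅_.bij G≅H)) S)
ClawFreeAfterDeleting-preimage G≅H clawFree a b c d a∉ b∉ c∉ d∉ =
  clawFree _ _ _ _ (a∉ ∘ ∈-preimage⁺) (b∉ ∘ ∈-preimage⁺) (c∉ ∘ ∈-preimage⁺) (d∉ ∘ ∈-preimage⁺)
  ∘ InducedClaw-≅ G≅H

IsCdn-resp-≅ : ∀ {n m k} {G : Graph n} {H : Graph m} → G ≅ H → IsCdn H k → IsCdn G k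
IsCdn-resp-≅ {k = k} {G} G≅H ((S , ∣S∣≡k , clawFree) , minimal) =
  (S′ , ≤-antisym ∣S′∣≤k (lower S′ clawFree′) , clawFree′) , lower
  where
  open Inverse (_≅_.bij G≅H)
  S′ = preimage to S
  clawFree′ = ClawFreeAfterDeleting-preimage G≅H clawFree
  ∣S′∣≤k : ∣ S′ ∣ ≤ k
  ∣S′∣≤k = subst (∣ S′ ∣ ≤_) ∣S∣≡k (∣preimage∣≤ (Injection.injective (↔⇒↣ (_≅_.bij G≅H))) S)
  lower : ∀ T → ClawFreeAfterDeleting G T → k ≤ ∣ T ∣
  lower T clawFreeT =
    ≤-trans (minimal _ (ClawFreeAfterDeleting-preimage (≅-sym G≅H) clawFreeT))
            (∣preimage∣≤ (Injection.injective (↔⇒↣ (↔-sym (_≅_.bij G≅H)))) T)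

data Corner : Set where
  centre leaf₁ leaf₂ leaf₃ : Corner

record ClawPacking {n : ℕ} (G : Graph n) (k : ℕ) : Set where
  field
    vertex   : Fin k → Corner → Fin n
    induced  : ∀ i → InducedClaw G (vertex i centre) (vertex i leaf₁) (vertex i leaf₂) (vertex i leaf₃)
    disjoint : ∀ i j p q → vertex i p ≡ vertex j q → i ≡ j

claw-meets : ∀ {n} {G : Graph n} {S} → ClawFreeAfterDeleting G S →
  (v : Corner → Fin n) → InducedClaw G (v centre) (v leaf₁) (v leaf₂) (v leaf₃) →
  ∃ λ p → v p ∈ S
claw-meets {S = S} clawFree v claw
  with v centre ∈? S | v leaf₁ ∈? S | v leaf₂ ∈? S | v leaf₃ ∈? S
... | yes a∈ | _      | _      | _      = centre , a∈
... | no _   | yes b∈ | _      | _      = leaf₁ , b∈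
... | no _   | no _   | yes c∈ | _      = leaf₂ , c∈
... | no _   | no _   | no _   | yes d∈ = leaf₃ , d∈
... | no a∉  | no b∉  | no c∉  | no d∉  = ⊥-elim (clawFree _ _ _ _ a∉ b∉ c∉ d∉ claw)

ClawPacking⇒≤∣∣ : ∀ {n k} {G : Graph n} → ClawPacking G k →
  ∀ S → ClawFreeAfterDeleting G S → k ≤ ∣ S ∣
ClawPacking⇒≤∣∣ {k = k} packing S clawFree = subst (_≤ ∣ S ∣) (∣⊤∣≡n k)
  (injectiveOn⇒∣∣≤ ⊤ S (λ i _ → vertex i (proj₁ (meet i))) (λ i _ → proj₂ (meet i))
    (λ i j _ _ → disjoint i j _ _))
  where
  open ClawPacking packing
  meet : ∀ i → ∃ λ p → vertex i p ∈ S
  meet i = claw-meets clawFree (vertex i) (induced i)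

IsCdn-fromPacking : ∀ {n k} {G : Graph n} → ClawPacking G k →
  ∀ S → ClawFreeAfterDeleting G S → ∣ S ∣ ≤ k → IsCdn G k
IsCdn-fromPacking packing S clawFree ∣S∣≤k =
  (S , ≤-antisym ∣S∣≤k (ClawPacking⇒≤∣∣ packing S clawFree) , clawFree) ,
  ClawPacking⇒≤∣∣ packing

-- Heap numbering and levels

data Child (c p : ℕ) : Set where
  left  : c ≡ 2 * p → Child c p
  right : c ≡ suc (2 * p) → Child c p

Child⇒2*≤ : ∀ {c p} → Child c p → 2 * p ≤ c
Child⇒2*≤ (left c≡) = ≤-reflexive (sym c≡)
Child⇒2*≤ (right c≡) = ≤-trans (n≤1+n _) (≤-reflexive (sym c≡))

Child⇒≤1+2* : ∀ {c p} → Child c p → c ≤ suc (2 * p)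
Child⇒≤1+2* (left c≡) = ≤-trans (≤-reflexive c≡) (n≤1+n _)
Child⇒≤1+2* (right c≡) = ≤-reflexive c≡

n<2*n : ∀ {n} → 1 ≤ n → n < 2 * n
n<2*n {suc n} _ = m<m+n (suc n) (s≤s z≤n)

Child⇒< : ∀ {c p} → 1 ≤ p → Child c p → p < c
Child⇒< 1≤p child = <-≤-trans (n<2*n 1≤p) (Child⇒2*≤ child)

Child-functional : ∀ {c p q} → Child c p → Child c q → p ≡ q
Child-functional {p = p} {q} (left c≡) (left c≡′) = *-cancelˡ-≡ p q 2 (trans (sym c≡) c≡′)
Child-functional {p = p} {q} (left c≡) (right c≡′) = ⊥-elim (even≢odd p q (trans (sym c≡) c≡′))
Child-functional {p = p} {q} (right c≡) (left c≡′) = ⊥-elim (even≢odd q p (trans (sym c≡′) c≡))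
Child-functional {p = p} {q} (right c≡) (right c≡′) =
  *-cancelˡ-≡ p q 2 (suc-injective (trans (sym c≡) c≡′))

at-most-two-children : ∀ {a x y z} → Child x a → Child y a → Child z a →
  x ≢ y → x ≢ z → y ≢ z → ⊥
at-most-two-children (left x≡) (left y≡) _ x≢y _ _ = x≢y (trans x≡ (sym y≡))
at-most-two-children (right x≡) (right y≡) _ x≢y _ _ = x≢y (trans x≡ (sym y≡))
at-most-two-children (left x≡) (right _) (left z≡) _ x≢z _ = x≢z (trans x≡ (sym z≡))
at-most-two-children (left _) (right y≡) (right z≡) _ _ y≢z = y≢z (trans y≡ (sym z≡))
at-most-two-children (right _) (left y≡) (left z≡) _ _ y≢z = y≢z (trans y≡ (sym z≡))
at-most-two-children (right x≡) (left _) (right z≡) _ x≢z _ = x≢z (trans x≡ (sym z≡))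

HeapAdj : ℕ → ℕ → Set
HeapAdj u v = Child u v ⊎ Child v u

¬HeapAdj : ∀ {x y q} → 1 ≤ x → x < y → Child y q → q ≢ x → ¬ HeapAdj x y
¬HeapAdj 1≤x x<y _ _ (inj₁ x-child) = <⇒≱ x<y (<⇒≤ (Child⇒< (≤-trans 1≤x (<⇒≤ x<y)) x-child))
¬HeapAdj _ _ y-child q≢x (inj₂ y-child′) = q≢x (Child-functional y-child y-child′)

-- Shifting the 0-based indices of Defs by one makes the children of u exactly 2u and 2u+1.
heap : ∀ {n} → Fin n → ℕ
heap x = suc (toℕ x)

heap-injective : ∀ {n} {x y : Fin n} → heap x ≡ heap y → x ≡ y
heap-injective = toℕ-injective ∘ suc-injective

fromHeap : ∀ {n} u → 1 ≤ u → u ≤ n → Fin n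
fromHeap (suc u) _ u<n = fromℕ< u<n

heap-fromHeap : ∀ {n} u (1≤u : 1 ≤ u) (u≤n : u ≤ n) → heap (fromHeap u 1≤u u≤n) ≡ u
heap-fromHeap (suc u) _ u<n = cong suc (toℕ-fromℕ< u<n)

ChildOf⇒Child : ∀ {n} {x y : Fin n} → ChildOf x y → Child (heap x) (heap y)
ChildOf⇒Child {y = y} (inj₁ x≡) =
  left (trans (cong suc (trans x≡ (+-comm _ 1))) (sym (*-suc 2 (toℕ y))))
ChildOf⇒Child {y = y} (inj₂ x≡) =
  right (cong suc (trans x≡ (trans (+-comm _ 2) (sym (*-suc 2 (toℕ y))))))

Child⇒ChildOf : ∀ {n} {x y : Fin n} → Child (heap x) (heap y) → ChildOf x y
Child⇒ChildOf {y = y} (left x≡) =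
  inj₁ (trans (suc-injective (trans x≡ (*-suc 2 (toℕ y)))) (+-comm 1 _))
Child⇒ChildOf {y = y} (right x≡) =
  inj₂ (trans (trans (suc-injective x≡) (*-suc 2 (toℕ y))) (+-comm 2 _))

fullBinaryTree⇒HeapAdj : ∀ {h} {x y : Fin (2 ^ suc h ∸ 1)} →
  Adj (fullBinaryTree h) x y → HeapAdj (heap x) (heap y)
fullBinaryTree⇒HeapAdj (inj₁ x-child) = inj₁ (ChildOf⇒Child x-child)
fullBinaryTree⇒HeapAdj (inj₂ y-child) = inj₂ (ChildOf⇒Child y-child)

InLevel : ℕ → ℕ → Set
InLevel ℓ u = 2 ^ ℓ ≤ u × u < 2 ^ suc ℓ

InLevel-unique : ∀ {ℓ m x} → InLevel ℓ x → InLevel m x → ℓ ≡ m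
InLevel-unique {ℓ} {m} (2^ℓ≤x , x<2^1+ℓ) (2^m≤x , x<2^1+m) with <-cmp ℓ m
... | tri< ℓ<m _ _ = ⊥-elim (<⇒≱ x<2^1+ℓ (≤-trans (^-monoʳ-≤ 2 ℓ<m) 2^m≤x))
... | tri≈ _ ℓ≡m _ = ℓ≡m
... | tri> _ _ m<ℓ = ⊥-elim (<⇒≱ x<2^1+m (≤-trans (^-monoʳ-≤ 2 m<ℓ) 2^ℓ≤x))

InLevel⇒< : ∀ {ℓ m x} → InLevel ℓ x → ℓ ≤ m → x < 2 ^ suc m
InLevel⇒< (_ , x<2^1+ℓ) ℓ≤m = <-≤-trans x<2^1+ℓ (^-monoʳ-≤ 2 (s≤s ℓ≤m))

1+2*-< : ∀ {a b} → a < b → suc (2 * a) < 2 * b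
1+2*-< {a} {b} a<b = subst (_≤ 2 * b) (*-suc 2 a) (*-monoʳ-≤ 2 a<b)

Child-InLevel : ∀ {ℓ c p} → Child c p → InLevel ℓ p → InLevel (suc ℓ) c
Child-InLevel child (2^ℓ≤p , p<2^1+ℓ) =
  ≤-trans (*-monoʳ-≤ 2 2^ℓ≤p) (Child⇒2*≤ child) ,
  ≤-<-trans (Child⇒≤1+2* child) (1+2*-< p<2^1+ℓ)

path-meets-level : ∀ {ℓ p a c} → Child a p → Child c a → 2 ^ ℓ ≤ c → c < 2 ^ (3 + ℓ) →
  ∃ λ u → InLevel ℓ u × (u ≡ p ⊎ u ≡ a ⊎ u ≡ c)
path-meets-level {ℓ} {p} {a} {c} a-child c-child 2^ℓ≤c c<2^3+ℓ with a <? 2 ^ ℓ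
... | yes a<2^ℓ = c , (2^ℓ≤c , ≤-<-trans (Child⇒≤1+2* c-child) (1+2*-< a<2^ℓ)) , inj₂ (inj₂ refl)
... | no a≮2^ℓ with a <? 2 ^ suc ℓ
...   | yes a<2^1+ℓ = a , (≮⇒≥ a≮2^ℓ , a<2^1+ℓ) , inj₂ (inj₁ refl)
...   | no a≮2^1+ℓ = p , (2^ℓ≤p , p<2^1+ℓ) , inj₁ refl
  where
  2^ℓ≤p : 2 ^ ℓ ≤ p
  2^ℓ≤p = ≮⇒≥ (λ p<2^ℓ → a≮2^1+ℓ (≤-<-trans (Child⇒≤1+2* a-child) (1+2*-< p<2^ℓ)))
  p<2^1+ℓ : p < 2 ^ suc ℓ
  p<2^1+ℓ = *-cancelˡ-< 2 p _ (≤-<-trans (Child⇒2*≤ a-child)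
              (*-cancelˡ-< 2 a _ (≤-<-trans (Child⇒2*≤ c-child) c<2^3+ℓ)))

-- The full binary tree of depth h

treeCdn : ℕ → ℕ
treeCdn 0 = 0
treeCdn 1 = 0
treeCdn 2 = 1
treeCdn (suc (suc (suc h))) = treeCdn h + 2 ^ suc h

newRoot : ℕ → ℕ → ℕ
newRoot h i = 2 ^ suc h + (i ∸ treeCdn h)

-- root h i is the heap index of the i-th deleted vertex, for i < treeCdn h.
root : ℕ → ℕ → ℕ
root 0 i = 1
root 1 i = 1
root 2 i = 1
root (suc (suc (suc h))) i with i <? treeCdn h
... | yes _ = root h i
... | no _  = newRoot h i

root-old : ∀ h {i} → i < treeCdn h → root (3 + h) i ≡ root h i
root-old h {i} i<F with i <? treeCdn h
... | yes _ = refl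
... | no i≮F = ⊥-elim (i≮F i<F)

root-new : ∀ h {i} → treeCdn h ≤ i → root (3 + h) i ≡ newRoot h i
root-new h {i} F≤i with i <? treeCdn h
... | yes i<F = ⊥-elim (<⇒≱ i<F F≤i)
... | no _ = refl

newRoot-InLevel : ∀ h {i} → treeCdn h ≤ i → i < treeCdn (3 + h) → InLevel (suc h) (newRoot h i)
newRoot-InLevel h {i} F≤i i<F+Q =
  m≤m+n Q _ , subst (Q + (i ∸ F) <_) (cong (Q +_) (sym (+-identityʳ Q))) (+-monoʳ-< Q i∸F<Q)
  where
  F = treeCdn h
  Q = 2 ^ suc h
  i∸F<Q : i ∸ F < Q
  i∸F<Q = subst (i ∸ F <_) (m+n∸m≡n F Q) (∸-monoˡ-< i<F+Q F≤i)

newRoot-injective : ∀ h {i j} → treeCdn h ≤ i → treeCdn h ≤ j → newRoot h i ≡ newRoot h j → i ≡ j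
newRoot-injective h {i} {j} F≤i F≤j same = begin
  i         ≡⟨ m∸n+n≡m F≤i ⟨
  i ∸ F + F ≡⟨ cong (_+ F) (+-cancelˡ-≡ (2 ^ suc h) (i ∸ F) (j ∸ F) same) ⟩
  j ∸ F + F ≡⟨ m∸n+n≡m F≤j ⟩
  j         ∎
  where
  open ≡-Reasoning
  F = treeCdn h

root-onto-level : ∀ h {u} → InLevel (suc h) u → ∃ λ i → i < treeCdn (3 + h) × root (3 + h) i ≡ u
root-onto-level h {u} (Q≤u , u<2Q) = F + (u ∸ Q) , +-monoʳ-< F u∸Q<Q , (begin
  root (3 + h) (F + (u ∸ Q)) ≡⟨ root-new h (m≤m+n F _) ⟩
  Q + (F + (u ∸ Q) ∸ F)      ≡⟨ cong (Q +_) (m+n∸m≡n F _) ⟩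
  Q + (u ∸ Q)                ≡⟨ m+[n∸m]≡n Q≤u ⟩
  u                          ∎)
  where
  open ≡-Reasoning
  F = treeCdn h
  Q = 2 ^ suc h
  u∸Q<Q : u ∸ Q < Q
  u∸Q<Q = subst (u ∸ Q <_) (trans (m+n∸m≡n Q (Q + 0)) (+-identityʳ Q)) (∸-monoˡ-< u<2Q Q≤u)

root-InLevel : ∀ h {i} → i < treeCdn h → ∃ λ ℓ → 3 + ℓ ≤ suc h × InLevel ℓ (root h i)
root-InLevel 2 _ = 0 , ≤-refl , ≤-refl , s≤s (s≤s z≤n)
root-InLevel (suc (suc (suc h))) {i} i<F′ with i <? treeCdn h
... | yes i<F = let ℓ , 3+ℓ≤1+h , level = root-InLevel h i<F in ℓ , m≤n⇒m≤o+n 3 3+ℓ≤1+h , level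
... | no i≮F = suc h , ≤-refl , newRoot-InLevel h (≮⇒≥ i≮F) i<F′

1≤root : ∀ h {i} → i < treeCdn h → 1 ≤ root h i
1≤root h i<F = let ℓ , _ , 2^ℓ≤root , _ = root-InLevel h i<F in ≤-trans (m^n>0 2 ℓ) 2^ℓ≤root

depth : Corner → ℕ
depth leaf₁ = 0
depth centre = 1
depth leaf₂ = 2
depth leaf₃ = 2

depth≤2 : ∀ p → depth p ≤ 2
depth≤2 leaf₁ = z≤n
depth≤2 centre = s≤s z≤n
depth≤2 leaf₂ = ≤-refl
depth≤2 leaf₃ = ≤-refl

clawAt : ℕ → Corner → ℕ
clawAt u centre = 2 * u
clawAt u leaf₁ = u
clawAt u leaf₂ = 2 * (2 * u)
clawAt u leaf₃ = suc (2 * (2 * u))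

u≤clawAt : ∀ u p → u ≤ clawAt u p
u≤clawAt u leaf₁ = ≤-refl
u≤clawAt u centre = m≤n*m u 2
u≤clawAt u leaf₂ = ≤-trans (m≤n*m u 2) (m≤n*m (2 * u) 2)
u≤clawAt u leaf₃ = ≤-trans (u≤clawAt u leaf₂) (n≤1+n _)

clawAt-InLevel : ∀ {ℓ u} p → InLevel ℓ u → InLevel (depth p + ℓ) (clawAt u p)
clawAt-InLevel leaf₁ level = level
clawAt-InLevel {ℓ} centre level = Child-InLevel {ℓ} (left refl) level
clawAt-InLevel {ℓ} leaf₂ level = Child-InLevel {suc ℓ} (left refl) (Child-InLevel {ℓ} (left refl) level)
clawAt-InLevel {ℓ} leaf₃ level = Child-InLevel {suc ℓ} (right refl) (Child-InLevel {ℓ} (left refl) level)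

clawAt-injective : ∀ {ℓ u v} p q → InLevel ℓ u → InLevel ℓ v → clawAt u p ≡ clawAt v q → u ≡ v
clawAt-injective {ℓ} {u} {v} p q u-level v-level same = same-depth p q depth≡ same
  where
  depth≡ : depth p ≡ depth q
  depth≡ = +-cancelʳ-≡ ℓ (depth p) (depth q)
    (InLevel-unique (clawAt-InLevel p u-level)
                    (subst (InLevel (depth q + ℓ)) (sym same) (clawAt-InLevel q v-level)))
  same-depth : ∀ p q → depth p ≡ depth q → clawAt u p ≡ clawAt v q → u ≡ v
  same-depth leaf₁ leaf₁ _ eq = eq
  same-depth centre centre _ eq = *-cancelˡ-≡ u v 2 eq
  same-depth leaf₂ leaf₂ _ eq = *-cancelˡ-≡ u v 2 (*-cancelˡ-≡ (2 * u) (2 * v) 2 eq)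
  same-depth leaf₃ leaf₃ _ eq = *-cancelˡ-≡ u v 2 (*-cancelˡ-≡ (2 * u) (2 * v) 2 (suc-injective eq))
  same-depth leaf₂ leaf₃ _ eq = ⊥-elim (even≢odd (2 * u) (2 * v) eq)
  same-depth leaf₃ leaf₂ _ eq = ⊥-elim (even≢odd (2 * v) (2 * u) (sym eq))
  same-depth leaf₁ centre () _
  same-depth leaf₁ leaf₂ () _
  same-depth leaf₁ leaf₃ () _
  same-depth centre leaf₁ () _
  same-depth centre leaf₂ () _
  same-depth centre leaf₃ () _
  same-depth leaf₂ leaf₁ () _
  same-depth leaf₂ centre () _
  same-depth leaf₃ leaf₁ () _
  same-depth leaf₃ centre () _

clawAt-bound : ∀ h {i} p → i < treeCdn h → clawAt (root h i) p < 2 ^ suc h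
clawAt-bound h p i<F =
  let ℓ , 3+ℓ≤1+h , level = root-InLevel h i<F
  in <-≤-trans (InLevel⇒< (clawAt-InLevel p level) (+-monoˡ-≤ ℓ (depth≤2 p)))
               (^-monoʳ-≤ 2 3+ℓ≤1+h)

oldClaw<newClaw : ∀ h {i j} p q → i < treeCdn h → clawAt (root h i) p < clawAt (newRoot h j) q
oldClaw<newClaw h p q i<F = <-≤-trans (clawAt-bound h p i<F) (≤-trans (m≤m+n _ _) (u≤clawAt _ q))

claws-disjoint : ∀ h {i j} p q → i < treeCdn h → j < treeCdn h →
  clawAt (root h i) p ≡ clawAt (root h j) q → i ≡ j
claws-disjoint 0 _ _ () _ _
claws-disjoint 1 _ _ () _ _
claws-disjoint 2 _ _ i<1 j<1 _ = trans (n<1⇒n≡0 i<1) (sym (n<1⇒n≡0 j<1))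
claws-disjoint (suc (suc (suc h))) {i} {j} p q i<F′ j<F′ same
  with i <? treeCdn h | j <? treeCdn h
... | yes i<F | yes j<F = claws-disjoint h p q i<F j<F same
... | yes i<F | no j≮F  = ⊥-elim (<⇒≢ (oldClaw<newClaw h p q i<F) same)
... | no i≮F  | yes j<F = ⊥-elim (<⇒≢ (oldClaw<newClaw h q p j<F) (sym same))
... | no i≮F  | no j≮F  = newRoot-injective h (≮⇒≥ i≮F) (≮⇒≥ j≮F)
      (clawAt-injective {suc h} p q (newRoot-InLevel h (≮⇒≥ i≮F) i<F′)
                                    (newRoot-InLevel h (≮⇒≥ j≮F) j<F′) same)

grandchild-≥ : ∀ {p a c} → Child a p → Child c a → 2 * (2 * p) ≤ c
grandchild-≥ a-child c-child = ≤-trans (*-monoʳ-≤ 2 (Child⇒2*≤ a-child)) (Child⇒2*≤ c-child)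

path-meets-root : ∀ h {p a c} → 1 ≤ p → Child a p → Child c a → c < 2 ^ suc h →
  ∃ λ i → i < treeCdn h × (root h i ≡ p ⊎ root h i ≡ a ⊎ root h i ≡ c)
path-meets-root 0 1≤p a-child c-child c<2 =
  ⊥-elim (<⇒≱ c<2 (≤-trans (*-monoʳ-≤ 2 1≤p) (≤-trans (m≤n*m _ 2) (grandchild-≥ a-child c-child))))
path-meets-root 1 1≤p a-child c-child c<4 =
  ⊥-elim (<⇒≱ c<4 (≤-trans (*-monoʳ-≤ 2 (*-monoʳ-≤ 2 1≤p)) (grandchild-≥ a-child c-child)))
path-meets-root 2 {suc zero} _ _ _ _ = 0 , s≤s z≤n , inj₁ refl
path-meets-root 2 {suc (suc p)} _ a-child c-child c<8 =
  ⊥-elim (<⇒≱ c<8 (≤-trans (*-monoʳ-≤ 2 (*-monoʳ-≤ 2 (s≤s (s≤s z≤n)))) (grandchild-≥ a-child c-child)))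
path-meets-root (suc (suc (suc h))) {p} {a} {c} 1≤p a-child c-child c<2^4+h with c <? 2 ^ suc h
... | yes c<2^1+h =
  let i , i<F , hit = path-meets-root h 1≤p a-child c-child c<2^1+h
  in i , <-≤-trans i<F (m≤m+n _ _) , subst (λ r → r ≡ p ⊎ r ≡ a ⊎ r ≡ c) (sym (root-old h i<F)) hit
... | no c≮2^1+h =
  let u , level , u-on-path = path-meets-level {suc h} a-child c-child (≮⇒≥ c≮2^1+h) c<2^4+h
      i , i<F , root≡u = root-onto-level h level
  in i , i<F , subst (λ r → r ≡ p ⊎ r ≡ a ⊎ r ≡ c) (sym root≡u) u-on-path

m<n∸1⇒1+m<n : ∀ {m n} → m < n ∸ 1 → suc m < n
m<n∸1⇒1+m<n {n = suc n} m<n = s≤s m<n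

heap<2^ : ∀ {h} (x : Fin (2 ^ suc h ∸ 1)) → heap x < 2 ^ suc h
heap<2^ x = m<n∸1⇒1+m<n (toℕ<n x)

heapClaw : ∀ {h u} (v : Corner → Fin (2 ^ suc h ∸ 1)) → 1 ≤ u → (∀ p → heap (v p) ≡ clawAt u p) →
  InducedClaw (fullBinaryTree h) (v centre) (v leaf₁) (v leaf₂) (v leaf₃)
heapClaw {h} {u} v 1≤u heap-v = record
  { a≢b = distinct centre leaf₁ (≢-sym (<⇒≢ u<2u))
  ; a≢c = distinct centre leaf₂ (<⇒≢ 2u<4u)
  ; a≢d = distinct centre leaf₃ (<⇒≢ (<-trans 2u<4u 4u<4u+1))
  ; b≢c = distinct leaf₁ leaf₂ (<⇒≢ u<4u)
  ; b≢d = distinct leaf₁ leaf₃ (<⇒≢ (<-trans u<4u 4u<4u+1))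
  ; c≢d = distinct leaf₂ leaf₃ (<⇒≢ 4u<4u+1)
  ; ab = edge centre leaf₁ (left refl)
  ; ac = swap (edge leaf₂ centre (left refl))
  ; ad = swap (edge leaf₃ centre (right refl))
  ; ¬bc = nonEdge leaf₁ leaf₂ (¬HeapAdj 1≤u u<4u (left refl) (≢-sym (<⇒≢ u<2u)))
  ; ¬bd = nonEdge leaf₁ leaf₃ (¬HeapAdj 1≤u (<-trans u<4u 4u<4u+1) (right refl) (≢-sym (<⇒≢ u<2u)))
  ; ¬cd = nonEdge leaf₂ leaf₃ (¬HeapAdj (≤-trans 1≤u (<⇒≤ u<4u)) 4u<4u+1 (right refl) (<⇒≢ 2u<4u))
  }
  where
  u<2u : u < 2 * u
  u<2u = n<2*n 1≤u
  2u<4u : 2 * u < 2 * (2 * u)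
  2u<4u = n<2*n (≤-trans 1≤u (<⇒≤ u<2u))
  u<4u : u < 2 * (2 * u)
  u<4u = <-trans u<2u 2u<4u
  4u<4u+1 : 2 * (2 * u) < suc (2 * (2 * u))
  4u<4u+1 = n<1+n _
  distinct : ∀ p q → clawAt u p ≢ clawAt u q → v p ≢ v q
  distinct p q ne vp≡vq = ne (trans (sym (heap-v p)) (trans (cong heap vp≡vq) (heap-v q)))
  edge : ∀ p q → Child (clawAt u p) (clawAt u q) → Adj (fullBinaryTree h) (v p) (v q)
  edge p q child = inj₁ (Child⇒ChildOf (subst₂ Child (sym (heap-v p)) (sym (heap-v q)) child))
  nonEdge : ∀ p q → ¬ HeapAdj (clawAt u p) (clawAt u q) → ¬ Adj (fullBinaryTree h) (v p) (v q)
  nonEdge p q ¬adj = ¬adj ∘ subst₂ HeapAdj (heap-v p) (heap-v q) ∘ fullBinaryTree⇒HeapAdj {h}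

claw-spine : ∀ {h a b c d} (P : Fin (2 ^ suc h ∸ 1) → Set) → P b → P c → P d →
  InducedClaw (fullBinaryTree h) a b c d →
  ∃₂ λ p q → P p × P q × Child (heap a) (heap p) × Child (heap q) (heap a)
claw-spine {h} {a} {b} {c} {d} P Pb Pc Pd claw =
  classify (toHeap ab) (toHeap ac) (toHeap ad)
  where
  open InducedClaw claw
  toHeap = fullBinaryTree⇒HeapAdj {h}
  Spine = ∃₂ λ p q → P p × P q × Child (heap a) (heap p) × Child (heap q) (heap a)
  heap-≢ : ∀ {x y : Fin (2 ^ suc h ∸ 1)} → x ≢ y → heap x ≢ heap y
  heap-≢ x≢y = x≢y ∘ heap-injective
  classify : HeapAdj (heap a) (heap b) → HeapAdj (heap a) (heap c) → HeapAdj (heap a) (heap d) → Spine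
  classify (inj₁ b-parent) (inj₁ c-parent) _ = ⊥-elim (heap-≢ b≢c (Child-functional b-parent c-parent))
  classify (inj₁ b-parent) (inj₂ c-child) _ = b , c , Pb , Pc , b-parent , c-child
  classify (inj₂ b-child) (inj₁ c-parent) _ = c , b , Pc , Pb , c-parent , b-child
  classify (inj₂ b-child) (inj₂ _) (inj₁ d-parent) = d , b , Pd , Pb , d-parent , b-child
  classify (inj₂ b-child) (inj₂ c-child) (inj₂ d-child) =
    ⊥-elim (at-most-two-children b-child c-child d-child (heap-≢ b≢c) (heap-≢ b≢d) (heap-≢ c≢d))

clawVertex : ∀ h → Fin (treeCdn h) → Corner → Fin (2 ^ suc h ∸ 1)
clawVertex h i p = fromHeap (clawAt (root h (toℕ i)) p)
  (≤-trans (1≤root h (toℕ<n i)) (u≤clawAt _ p)) (∸-monoˡ-≤ 1 (clawAt-bound h p (toℕ<n i)))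

heap-clawVertex : ∀ h i p → heap (clawVertex h i p) ≡ clawAt (root h (toℕ i)) p
heap-clawVertex h i p = heap-fromHeap _ _ _

treePacking : ∀ h → ClawPacking (fullBinaryTree h) (treeCdn h)
treePacking h = record
  { vertex   = clawVertex h
  ; induced  = λ i → heapClaw {h} (clawVertex h i) (1≤root h (toℕ<n i)) (heap-clawVertex h i)
  ; disjoint = λ i j p q same → toℕ-injective (claws-disjoint h p q (toℕ<n i) (toℕ<n j)
      (trans (sym (heap-clawVertex h i p)) (trans (cong heap same) (heap-clawVertex h j q))))
  }

deleted : ∀ h → Subset (2 ^ suc h ∸ 1)
deleted h = image (λ i → clawVertex h i leaf₁)

root∈deleted : ∀ h {i} → i < treeCdn h → ∀ {x} → root h i ≡ heap x → x ∈ deleted h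
root∈deleted h {i} i<F root≡heap = subst (_∈ deleted h)
  (heap-injective (trans (heap-clawVertex h i′ leaf₁)
                         (trans (cong (root h) (toℕ-fromℕ< i<F)) root≡heap)))
  (∈-image⁺ i′)
  where i′ = fromℕ< i<F

deleted-clawFree : ∀ h → ClawFreeAfterDeleting (fullBinaryTree h) (deleted h)
deleted-clawFree h a b c d a∉ b∉ c∉ d∉ claw =
  let p , q , p∉ , q∉ , a-child , q-child = claw-spine {h} (λ x → x ∉ deleted h) b∉ c∉ d∉ claw
      i , i<F , hit = path-meets-root h (s≤s z≤n) a-child q-child (heap<2^ {h} q)
      hits = root∈deleted h i<F
  in [ p∉ ∘ hits , [ a∉ ∘ hits , q∉ ∘ hits ] ] hit

fullBinaryTree-cdn : ∀ h → IsCdn (fullBinaryTree h) (treeCdn h)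
fullBinaryTree-cdn h =
  IsCdn-fromPacking (treePacking h) (deleted h) (deleted-clawFree h)
    (∣image∣≤ (λ i → clawVertex h i leaf₁))

-- The closed form

treeCdn-closedForm : ∀ h → 7 * treeCdn h + 2 ^ (suc h % 3) ≡ 2 ^ suc h
treeCdn-closedForm 0 = refl
treeCdn-closedForm 1 = refl
treeCdn-closedForm 2 = refl
treeCdn-closedForm (suc (suc (suc h))) = begin
  7 * (F + Q) + 2 ^ ((3 + suc h) % 3) ≡⟨ cong (λ e → 7 * (F + Q) + 2 ^ e) period ⟩
  7 * (F + Q) + r                     ≡⟨ solve 3 (λ f q r → con 7 :* (f :+ q) :+ r
                                                         := (con 7 :* f :+ r) :+ con 7 :* q) refl F Q r ⟩
  (7 * F + r) + 7 * Q                 ≡⟨ cong (_+ 7 * Q) (treeCdn-closedForm h) ⟩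
  Q + 7 * Q                           ≡⟨ solve 1 (λ q → q :+ con 7 :* q
                                                     := con 2 :* (con 2 :* (con 2 :* q))) refl Q ⟩
  2 * (2 * (2 * Q))                   ∎
  where
  open ≡-Reasoning
  open +-*-Solver
  F = treeCdn h
  Q = 2 ^ suc h
  r = 2 ^ (suc h % 3)
  period : (3 + suc h) % 3 ≡ suc h % 3
  period = trans (cong (_% 3) (+-comm 3 (suc h))) ([m+n]%n≡m%n (suc h) 3)

cdnFormula : ℕ → ℕ
cdnFormula n = (n + 1 ∸ 2 ^ (⌊log₂ (n + 1) ⌋ % 3)) / 7

cdnFormula-fullBinaryTree : ∀ h → cdnFormula (2 ^ suc h ∸ 1) ≡ treeCdn h
cdnFormula-fullBinaryTree h = begin
  cdnFormula (Q ∸ 1)              ≡⟨ cong (λ m → (m ∸ 2 ^ (⌊log₂ m ⌋ % 3)) / 7) (m∸n+n≡m (m^n>0 2 (suc h))) ⟩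
  (Q ∸ 2 ^ (⌊log₂ Q ⌋ % 3)) / 7   ≡⟨ cong (λ e → (Q ∸ 2 ^ (e % 3)) / 7) (⌊log₂[2^n]⌋≡n (suc h)) ⟩
  (Q ∸ r) / 7                     ≡⟨ cong (λ m → (m ∸ r) / 7) (treeCdn-closedForm h) ⟨
  (7 * F + r ∸ r) / 7             ≡⟨ cong (_/ 7) (trans (m+n∸n≡m (7 * F) r) (*-comm 7 F)) ⟩
  (F * 7) / 7                     ≡⟨ m*n/n≡m F 7 ⟩
  F                               ∎
  where
  open ≡-Reasoning
  F = treeCdn h
  Q = 2 ^ suc h
  r = 2 ^ (suc h % 3)

corollary1 : (n : ℕ) (T : Graph n) → IsFullBinaryTree T →
    IsCdn T ((n + 1 ∸ 2 ^ (⌊log₂ (n + 1) ⌋ % 3)) / 7)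
corollary1 n T (h , T≅tree) = subst (IsCdn T) (sym cdn≡) (IsCdn-resp-≅ T≅tree (fullBinaryTree-cdn h))
  where
  cdn≡ : cdnFormula n ≡ treeCdn h
  cdn≡ = trans (cong cdnFormula (↔⇒≡ (_≅_.bij T≅tree))) (cdnFormula-fullBinaryTree h)
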